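{- Let $S=\{s_1<\dots<s_n\}\subset\mathbb{N}$ with $n\ge 4$. Then $S$ cannot have two different symmetry types simultaneously.
   Context: For $R,R'\subset\mathbb{Q}$, $R'$ is a copy of $R$ if $R'=aR+b$ for some rational $a>0$ and rational $b$. $S$ has symmetry type $(i,j)$ (with $1\le i<j\le n$) if $S\setminus\{s_i\}$ is a copy of $S\setminus\{s_j\}$. -}

module Defs where

open import Data.Nat using (ℕ)
open import Data.Fin using (Fin)
open import Data.Integer using (+_)
open import Data.Rational using (ℚ; _/_; _+_; _*_; _<_; 0ℚ)
open import Data.Product using (Σ; ∃; _×_)
open import Relation.Binary.PropositionalEquality using (_≡_; _≢_)
open import Relation.Unary using (Pred)
open import Level using (0ℓ)

ℕ→ℚ : ℕ → ℚ
ℕ→ℚ m = + m / 1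

QSet : Set₁
QSet = Pred ℚ 0ℓ

IsCopy : QSet → QSet → Set
IsCopy R' R = Σ ℚ λ a → Σ ℚ λ b → (0ℚ < a) ×
  ((y : ℚ) → (R' y → ∃ λ x → R x × y ≡ a * x + b)
           × ((∃ λ x → R x × y ≡ a * x + b) → R' y))

-- S = {s_0 < ... < s_{n-1}} given by a strictly increasing map s : Fin n → ℕ
StrictlyIncreasing : ∀ {n} → (Fin n → ℕ) → Set
StrictlyIncreasing {n} s = ∀ (k l : Fin n) → k Data.Fin.< l → s k Data.Nat.< s l

Remove : ∀ {n} → (Fin n → ℕ) → Fin n → QSet
Remove {n} s i y = ∃ λ (k : Fin n) → k ≢ i × y ≡ ℕ→ℚ (s k)

HasSymType : ∀ {n} → (Fin n → ℕ) → Fin n → Fin n → Set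
HasSymType s i j = i Data.Fin.< j × IsCopy (Remove s i) (Remove s j)

-- An increasing affine map y ↦ a y + b carrying S ∖ {s_j} onto S ∖ {s_i} must send the k-th
-- smallest element to the k-th smallest one: it fixes s_k for k < i and k > j and sends s_k to
-- s_{k+1} for i ≤ k < j. It cannot fix two points of S, for then it would be the identity, and this
-- leaves only the types (1,n), (1,n-1) and (2,n). Maps of two different types both send s_2 to s_3
-- and either s_1 to s_2 or s_3 to s_4, so they coincide, which contradicts what they do at s_1 or
-- s_n. The exception is the pair (1,3), (2,4) for n = 4: there the gaps p = s_2 - s_1 and
-- q = s_3 - s_2 satisfy q² + qp = p², impossible since the golden ratio is irrational.
module Submission where

open import Defs
open import Data.Nat as ℕ using (ℕ; zero; suc; _≤_; z≤n; s≤s)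
import Data.Nat.Properties as ℕₚ
open import Data.Fin as Fin using (Fin; zero; suc; toℕ; inject₁; fromℕ; punchIn; punchOut)
import Data.Fin.Properties as Finₚ
open import Data.Rational as ℚ using (ℚ)
import Data.Rational.Properties as ℚₚ
open import Data.Product using (Σ; _×_; _,_; proj₁; proj₂)
open import Data.Empty using (⊥; ⊥-elim)
open import Function using (_∘_)
open import Relation.Nullary using (yes; no; contradiction)
open import Relation.Binary.PropositionalEquality
  using (_≡_; _≢_; refl; sym; trans; cong; cong₂; subst; subst₂; module ≡-Reasoning)

module _ where
  open import Data.Nat
  open ℕₚ
  open import Data.Nat.Induction using (<-wellFounded)
  open import Induction.WellFounded using (Acc; acc)
  open import Data.Nat.Solver using (module +-*-Solver)
  open +-*-Solver

  -- The golden ratio is irrational: a solution (p, q) yields the smaller solution (q, p ∸ q).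
  q*q+q*p≢p*p : ∀ p q → 0 < q → q * q + q * p ≢ p * p
  q*q+q*p≢p*p p = descend p (<-wellFounded p)
    where
    descend : ∀ p → Acc _<_ p → ∀ q → 0 < q → q * q + q * p ≢ p * p
    descend p (acc smaller) q 0<q e = descend q (smaller q<p) d (m<n⇒0<n∸m q<p) d*d+d*q≡q*q
      where
      q<p : q < p
      q<p = ≰⇒> λ p≤q → <-irrefl refl (begin-strict
        p * p         ≤⟨ *-monoˡ-≤ p p≤q ⟩
        q * p         <⟨ m<n+m (q * p) (*-mono-< 0<q 0<q) ⟩
        q * q + q * p ≡⟨ e ⟩
        p * p         ∎)
        where open ≤-Reasoning
      d = p ∸ q
      p≡q+d : p ≡ q + d
      p≡q+d = sym (m+[n∸m]≡n (<⇒≤ q<p))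
      d*d+d*q≡q*q : d * d + d * q ≡ q * q
      d*d+d*q≡q*q = sym (+-cancelˡ-≡ (q * q + q * d) _ _ (begin
        (q * q + q * d) + q * q       ≡⟨ solve 2 (λ q d → (q :* q :+ q :* d) :+ q :* q := q :* q :+ q :* (q :+ d)) refl q d ⟩
        q * q + q * (q + d)           ≡⟨ subst (λ z → q * q + q * z ≡ z * z) p≡q+d e ⟩
        (q + d) * (q + d)             ≡⟨ solve 2 (λ q d → (q :+ d) :* (q :+ d) := (q :* q :+ q :* d) :+ (d :* d :+ d :* q)) refl q d ⟩
        (q * q + q * d) + (d * d + d * q) ∎))
        where open ≡-Reasoning

  no-golden-gaps : ∀ p q w → 0 < q → q * (q + w) ≡ p * w → (p + q) * q ≡ p * w → ⊥
  no-golden-gaps p q w 0<q qq+w≡pw p+qq≡pw =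
    q*q+q*p≢p*p p q 0<q (subst (λ z → q * q + q * z ≡ p * z) w≡p (trans (sym (*-distribˡ-+ q q w)) qq+w≡pw))
    where
    open ≡-Reasoning
    w≡p : w ≡ p
    w≡p = *-cancelˡ-≡ w p q {{>-nonZero 0<q}} (+-cancelˡ-≡ (q * q) _ _ (begin
      q * q + q * w ≡⟨ *-distribˡ-+ q q w ⟨
      q * (q + w)   ≡⟨ trans qq+w≡pw (sym p+qq≡pw) ⟩
      (p + q) * q   ≡⟨ solve 2 (λ p q → (p :+ q) :* q := q :* q :+ q :* p) refl p q ⟩
      q * q + q * p ∎))

module _ where
  open import Data.Nat.Coprimality using (1-coprimeTo) renaming (sym to coprime-sym)
  open import Data.Integer as ℤ using (+_)
  import Data.Integer.Properties as ℤₚ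
  open import Data.Rational using (mkℚ; _+_; _*_; _<_)

  ℕ→ℚ≡mkℚ : ∀ m → ℕ→ℚ m ≡ mkℚ (+ m) 0 (coprime-sym (1-coprimeTo m))
  ℕ→ℚ≡mkℚ m = ℚₚ.normalize-coprime (coprime-sym (1-coprimeTo m))

  ℕ→ℚ-homo-+ : ∀ m n → ℕ→ℚ (m ℕ.+ n) ≡ ℕ→ℚ m + ℕ→ℚ n
  ℕ→ℚ-homo-+ m n rewrite ℕ→ℚ≡mkℚ m | ℕ→ℚ≡mkℚ n =
    ℚₚ./-cong {+ (m ℕ.+ n)} {1} (cong₂ ℤ._+_ (sym (ℤₚ.*-identityʳ (+ m))) (sym (ℤₚ.*-identityʳ (+ n)))) refl

  ℕ→ℚ-homo-* : ∀ m n → ℕ→ℚ (m ℕ.* n) ≡ ℕ→ℚ m * ℕ→ℚ n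
  ℕ→ℚ-homo-* m n rewrite ℕ→ℚ≡mkℚ m | ℕ→ℚ≡mkℚ n = ℚₚ./-cong {+ (m ℕ.* n)} {1} (ℤₚ.pos-* m n) refl

  ℕ→ℚ-mono-< : ∀ {m n} → m ℕ.< n → ℕ→ℚ m < ℕ→ℚ n
  ℕ→ℚ-mono-< {m} {n} m<n rewrite ℕ→ℚ≡mkℚ m | ℕ→ℚ≡mkℚ n =
    ℚ.*<* (subst₂ ℤ._<_ (sym (ℤₚ.*-identityʳ (+ m))) (sym (ℤₚ.*-identityʳ (+ n))) (ℤ.+<+ m<n))

  ℕ→ℚ-injective : ∀ {m n} → ℕ→ℚ m ≡ ℕ→ℚ n → m ≡ n
  ℕ→ℚ-injective {m} {n} eq rewrite ℕ→ℚ≡mkℚ m | ℕ→ℚ≡mkℚ n with eq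
  ... | refl = refl

  ℕ→ℚ-gap : ∀ {m n} → m ℕ.≤ n → ℕ→ℚ n ≡ ℕ→ℚ m + ℕ→ℚ (n ℕ.∸ m)
  ℕ→ℚ-gap {m} m≤n = trans (cong ℕ→ℚ (sym (ℕₚ.m+[n∸m]≡n m≤n))) (ℕ→ℚ-homo-+ m _)

module _ where
  open import Data.Rational using (_+_; _*_; _-_; _<_; 0ℚ; 1ℚ; 1/_)
  open ℚₚ using (<-cmp; <-irrefl)
  open import Data.Rational.Solver using (module +-*-Solver)
  open +-*-Solver
  open import Relation.Binary.Definitions using (tri<; tri≈; tri>)
  open ≡-Reasoning

  *-cancelʳ-≢0 : ∀ {a c d} → d ≢ 0ℚ → a * d ≡ c * d → a ≡ c
  *-cancelʳ-≢0 {a} {c} {d} d≢0 ad≡cd = begin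
    a                ≡⟨ divide a ⟨
    a * d * (1/ d)   ≡⟨ cong (_* (1/ d)) ad≡cd ⟩
    c * d * (1/ d)   ≡⟨ divide c ⟩
    c                ∎
    where
    instance _ = ℚ.≢-nonZero d≢0
    divide : ∀ z → z * d * (1/ d) ≡ z
    divide z = trans (ℚₚ.*-assoc z d (1/ d)) (trans (cong (z *_) (ℚₚ.*-inverseʳ d)) (ℚₚ.*-identityʳ z))

  affine-step : ∀ {a b u v u′ v′ d d′} → a * u + b ≡ u′ → a * v + b ≡ v′ →
                v ≡ u + d → v′ ≡ u′ + d′ → a * d ≡ d′
  affine-step {a} {b} {u} {v} {u′} {v′} {d} {d′} fu fv v≡u+d v′≡u′+d′ = begin
    a * d                           ≡⟨ solve 4 (λ a b u d → a :* d := (a :* (u :+ d) :+ b) :- (a :* u :+ b)) refl a b u d ⟩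
    (a * (u + d) + b) - (a * u + b) ≡⟨ cong₂ _-_ (trans (cong (λ z → a * z + b) (sym v≡u+d)) (trans fv v′≡u′+d′)) fu ⟩
    (u′ + d′) - u′                  ≡⟨ solve 2 (λ u′ d′ → (u′ :+ d′) :- u′ := d′) refl u′ d′ ⟩
    d′                              ∎

  affine-determined : ∀ {a b c e u v} → a * u + b ≡ c * u + e → a * v + b ≡ c * v + e → u ≢ v → a ≡ c × b ≡ e
  affine-determined {a} {b} {c} {e} {u} {v} eu ev u≢v = a≡c , b≡e
    where
    d = v - u
    v≡u+d : v ≡ u + d
    v≡u+d = solve 2 (λ u v → v := u :+ (v :- u)) refl u v
    d≢0 : d ≢ 0ℚ
    d≢0 d≡0 = u≢v (sym (trans v≡u+d (trans (cong (u +_) d≡0) (ℚₚ.+-identityʳ u))))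
    a≡c : a ≡ c
    a≡c = *-cancelʳ-≢0 d≢0 (affine-step {a} {b} {u} {v} {c * u + e} {c * v + e} {d} {c * d} eu ev v≡u+d c[u+d]+e)
      where
      c[u+d]+e : c * v + e ≡ (c * u + e) + c * d
      c[u+d]+e = trans (cong (λ z → c * z + e) v≡u+d) (solve 4 (λ c e u d → c :* (u :+ d) :+ e := (c :* u :+ e) :+ c :* d) refl c e u d)
    b≡e : b ≡ e
    b≡e = begin
      b                 ≡⟨ solve 3 (λ a b u → b := (a :* u :+ b) :- a :* u) refl a b u ⟩
      (a * u + b) - a * u ≡⟨ cong₂ (λ y z → y - z * u) eu a≡c ⟩
      (c * u + e) - c * u ≡⟨ solve 3 (λ c e u → (c :* u :+ e) :- c :* u := e) refl c e u ⟩
      e                 ∎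

  1*z+0≡z : ∀ z → 1ℚ * z + 0ℚ ≡ z
  1*z+0≡z z = trans (ℚₚ.+-identityʳ (1ℚ * z)) (ℚₚ.*-identityˡ z)

  affine-identity : ∀ {a b u v} → a * u + b ≡ u → a * v + b ≡ v → u ≢ v → ∀ z → a * z + b ≡ z
  affine-identity {a} {b} {u} {v} fu fv u≢v z =
    trans (cong₂ (λ a b → a * z + b) a≡1 b≡0) (1*z+0≡z z)
    where
    a≡1×b≡0 : a ≡ 1ℚ × b ≡ 0ℚ
    a≡1×b≡0 = affine-determined {a} {b} {1ℚ} {0ℚ} {u} {v} (trans fu (sym (1*z+0≡z u))) (trans fv (sym (1*z+0≡z v))) u≢v
    a≡1 = proj₁ a≡1×b≡0
    b≡0 = proj₂ a≡1×b≡0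

  affine-strictMono : ∀ {a b u v} → 0ℚ < a → u < v → a * u + b < a * v + b
  affine-strictMono {a} {b} 0<a u<v = ℚₚ.+-monoˡ-< b (ℚₚ.*-monoʳ-<-pos a u<v)
    where instance _ = ℚ.positive 0<a

  affine-injective : ∀ {a b u v} → 0ℚ < a → a * u + b ≡ a * v + b → u ≡ v
  affine-injective {a} {b} {u} {v} 0<a fu≡fv with <-cmp u v
  ... | tri< u<v _ _ = contradiction fu≡fv (λ eq → <-irrefl eq (affine-strictMono {a} {b} 0<a u<v))
  ... | tri≈ _ u≡v _ = u≡v
  ... | tri> _ _ v<u = contradiction (sym fu≡fv) (λ eq → <-irrefl eq (affine-strictMono {a} {b} 0<a v<u))

  three-step-clash : ∀ {a b c e u₀ u₁ u₂ u₃} →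
    a * u₀ + b ≡ u₁ → a * u₁ + b ≡ u₂ → a * u₂ + b ≡ u₃ →
    c * u₀ + e ≡ u₀ → c * u₁ + e ≡ u₂ → c * u₂ + e ≡ u₃ → u₁ ≢ u₂ → u₀ ≡ u₁
  three-step-clash {a} {b} {c} {e} {u₀} {u₁} {u₂} f₀ f₁ f₂ g₀ g₁ g₂ u₁≢u₂ = begin
    u₀          ≡⟨ g₀ ⟨
    c * u₀ + e  ≡⟨ cong₂ (λ a b → a * u₀ + b) a≡c b≡e ⟨
    a * u₀ + b  ≡⟨ f₀ ⟩
    u₁          ∎
    where
    a≡c×b≡e : a ≡ c × b ≡ e
    a≡c×b≡e = affine-determined {a} {b} {c} {e} {u₁} {u₂} (trans f₁ (sym g₁)) (trans f₂ (sym g₂)) u₁≢u₂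
    a≡c = proj₁ a≡c×b≡e
    b≡e = proj₂ a≡c×b≡e

  scale-swap : ∀ {a p q r t} → a * p ≡ q → a * r ≡ t → q * r ≡ p * t
  scale-swap {a} {p} {q} {r} {t} ap≡q ar≡t = begin
    q * r       ≡⟨ cong (_* r) ap≡q ⟨
    a * p * r   ≡⟨ solve 3 (λ a p r → a :* p :* r := p :* (a :* r)) refl a p r ⟩
    p * (a * r) ≡⟨ cong (p *_) ar≡t ⟩
    p * t       ∎

  golden-gap-equations : ∀ {a b c e x₀ x₁ x₂ x₃ p q w} →
    x₁ ≡ x₀ + p → x₂ ≡ x₁ + q → x₃ ≡ x₂ + w →
    a * x₀ + b ≡ x₁ → a * x₁ + b ≡ x₂ → a * x₃ + b ≡ x₃ →
    c * x₀ + e ≡ x₀ → c * x₁ + e ≡ x₂ → c * x₂ + e ≡ x₃ →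
    q * (q + w) ≡ p * w × (p + q) * q ≡ p * w
  golden-gap-equations {a} {b} {c} {e} {x₀} {x₁} {x₂} {x₃} {p} {q} {w} x₁≡ x₂≡ x₃≡ f₀ f₁ f₃ g₀ g₁ g₂ =
    scale-swap {a} ap≡q a[q+w]≡w , scale-swap {c} cp≡p+q cq≡w
    where
    x₃≡x₁+[q+w] : x₃ ≡ x₁ + (q + w)
    x₃≡x₁+[q+w] = trans x₃≡ (trans (cong (_+ w) x₂≡) (ℚₚ.+-assoc x₁ q w))
    x₂≡x₀+[p+q] : x₂ ≡ x₀ + (p + q)
    x₂≡x₀+[p+q] = trans x₂≡ (trans (cong (_+ q) x₁≡) (ℚₚ.+-assoc x₀ p q))
    ap≡q : a * p ≡ q
    ap≡q = affine-step {a} {b} {x₀} {x₁} {x₁} {x₂} f₀ f₁ x₁≡ x₂≡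
    a[q+w]≡w : a * (q + w) ≡ w
    a[q+w]≡w = affine-step {a} {b} {x₁} {x₃} {x₂} {x₃} f₁ f₃ x₃≡x₁+[q+w] x₃≡
    cp≡p+q : c * p ≡ p + q
    cp≡p+q = affine-step {c} {e} {x₀} {x₁} {x₀} {x₂} g₀ g₁ x₁≡ x₂≡x₀+[p+q]
    cq≡w : c * q ≡ w
    cq≡w = affine-step {c} {e} {x₁} {x₂} {x₂} {x₃} g₁ g₂ x₂≡ x₃≡

module _ where
  open import Data.Rational using (_+_; _*_)

  golden-clash : ∀ {s₀ s₁ s₂ s₃ a b c e} → s₀ ℕ.≤ s₁ → s₁ ℕ.< s₂ → s₂ ℕ.≤ s₃ →
    a * ℕ→ℚ s₀ + b ≡ ℕ→ℚ s₁ → a * ℕ→ℚ s₁ + b ≡ ℕ→ℚ s₂ → a * ℕ→ℚ s₃ + b ≡ ℕ→ℚ s₃ →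
    c * ℕ→ℚ s₀ + e ≡ ℕ→ℚ s₀ → c * ℕ→ℚ s₁ + e ≡ ℕ→ℚ s₂ → c * ℕ→ℚ s₂ + e ≡ ℕ→ℚ s₃ → ⊥
  golden-clash {s₀} {s₁} {s₂} {s₃} {a} {b} {c} {e} s₀≤s₁ s₁<s₂ s₂≤s₃ f₀ f₁ f₃ g₀ g₁ g₂ =
    no-golden-gaps p q w (ℕₚ.m<n⇒0<n∸m s₁<s₂) (ℕ→ℚ-injective (begin
      ℕ→ℚ (q ℕ.* (q ℕ.+ w))           ≡⟨ ℕ→ℚ-homo-* q (q ℕ.+ w) ⟩
      ℕ→ℚ q * ℕ→ℚ (q ℕ.+ w)           ≡⟨ cong (ℕ→ℚ q *_) (ℕ→ℚ-homo-+ q w) ⟩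
      ℕ→ℚ q * (ℕ→ℚ q + ℕ→ℚ w)         ≡⟨ proj₁ gap-equations ⟩
      ℕ→ℚ p * ℕ→ℚ w                   ≡⟨ ℕ→ℚ-homo-* p w ⟨
      ℕ→ℚ (p ℕ.* w)                   ∎))
    (ℕ→ℚ-injective (begin
      ℕ→ℚ ((p ℕ.+ q) ℕ.* q)           ≡⟨ ℕ→ℚ-homo-* (p ℕ.+ q) q ⟩
      ℕ→ℚ (p ℕ.+ q) * ℕ→ℚ q           ≡⟨ cong (_* ℕ→ℚ q) (ℕ→ℚ-homo-+ p q) ⟩
      (ℕ→ℚ p + ℕ→ℚ q) * ℕ→ℚ q         ≡⟨ proj₂ gap-equations ⟩
      ℕ→ℚ p * ℕ→ℚ w                   ≡⟨ ℕ→ℚ-homo-* p w ⟨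
      ℕ→ℚ (p ℕ.* w)                   ∎))
    where
    open ≡-Reasoning
    p = s₁ ℕ.∸ s₀
    q = s₂ ℕ.∸ s₁
    w = s₃ ℕ.∸ s₂
    gap-equations : ℕ→ℚ q * (ℕ→ℚ q + ℕ→ℚ w) ≡ ℕ→ℚ p * ℕ→ℚ w × (ℕ→ℚ p + ℕ→ℚ q) * ℕ→ℚ q ≡ ℕ→ℚ p * ℕ→ℚ w
    gap-equations = golden-gap-equations {a} {b} {c} {e} {ℕ→ℚ s₀} {ℕ→ℚ s₁} {ℕ→ℚ s₂} {ℕ→ℚ s₃}
      (ℕ→ℚ-gap s₀≤s₁) (ℕ→ℚ-gap (ℕₚ.<⇒≤ s₁<s₂)) (ℕ→ℚ-gap s₂≤s₃) f₀ f₁ f₃ g₀ g₁ g₂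

punchIn-< : ∀ {n} (i : Fin (suc n)) (k : Fin n) → toℕ k ℕ.< toℕ i → punchIn i k ≡ inject₁ k
punchIn-< (suc i) zero    _         = refl
punchIn-< (suc i) (suc k) (s≤s k<i) = cong suc (punchIn-< i k k<i)

punchIn-≥ : ∀ {n} (i : Fin (suc n)) (k : Fin n) → toℕ i ℕ.≤ toℕ k → punchIn i k ≡ suc k
punchIn-≥ zero    k       _         = refl
punchIn-≥ (suc i) (suc k) (s≤s i≤k) = cong suc (punchIn-≥ i k i≤k)

punchIn-mono-< : ∀ {n} (i : Fin (suc n)) {k l} → k Fin.< l → punchIn i k Fin.< punchIn i l
punchIn-mono-< i {k} {l} k<l = ℕₚ.≰⇒> (ℕₚ.<⇒≱ k<l ∘ Finₚ.punchIn-cancel-≤ i l k)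

punchIn-cancel-< : ∀ {n} (i : Fin (suc n)) {k l} → punchIn i k Fin.< punchIn i l → k Fin.< l
punchIn-cancel-< i {k} {l} ik<il = ℕₚ.≰⇒> (ℕₚ.<⇒≱ ik<il ∘ Finₚ.punchIn-mono-≤ i l k)

inject₁<suc : ∀ {n} (k : Fin n) → inject₁ k Fin.< suc k
inject₁<suc k = s≤s (ℕₚ.≤-reflexive (Finₚ.toℕ-inject₁ k))

inject₁≢suc : ∀ {n} (k : Fin n) → inject₁ k ≢ suc k
inject₁≢suc k = Finₚ.<⇒≢ (inject₁<suc k)

strictlyIncreasing⇒≡id : ∀ {n} (σ : Fin n → Fin n) → (∀ {k l} → k Fin.< l → σ k Fin.< σ l) → ∀ k → σ k ≡ k
strictlyIncreasing⇒≡id {suc n} σ σ-inc k = Finₚ.≤-antisym (σ≤id k) (id≤σ k)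
  where
  open import Data.Fin.Induction using (<-weakInduction; >-weakInduction)
  id≤σ : ∀ k → k Fin.≤ σ k
  id≤σ = <-weakInduction (λ k → k Fin.≤ σ k) z≤n λ k k≤σk →
    ℕₚ.≤-trans (s≤s (subst (ℕ._≤ toℕ (σ (inject₁ k))) (Finₚ.toℕ-inject₁ k) k≤σk)) (σ-inc (inject₁<suc k))
  σ≤id : ∀ k → σ k Fin.≤ k
  σ≤id = >-weakInduction (λ k → σ k Fin.≤ k) (Finₚ.≤fromℕ (σ (fromℕ n))) λ k σk≤k →
    subst (toℕ (σ (inject₁ k)) ℕ.≤_) (sym (Finₚ.toℕ-inject₁ k)) (ℕₚ.≤-pred (ℕₚ.<-≤-trans (σ-inc (inject₁<suc k)) σk≤k))

module Symmetries {m} (s : Fin (suc m) → ℕ) (s-inc : StrictlyIncreasing s) where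
  open import Data.Rational using (_+_; _*_; _<_; 0ℚ)
  open import Relation.Binary.Definitions using (tri<; tri≈; tri>)

  x : Fin (suc m) → ℚ
  x k = ℕ→ℚ (s k)

  x-mono : ∀ {k l} → k Fin.< l → x k < x l
  x-mono {k} {l} k<l = ℕ→ℚ-mono-< (s-inc k l k<l)

  x-cancel-< : ∀ {k l} → x k < x l → k Fin.< l
  x-cancel-< {k} {l} xk<xl with Finₚ.<-cmp k l
  ... | tri< k<l _ _ = k<l
  ... | tri≈ _ refl _ = ⊥-elim (ℚₚ.<-irrefl refl xk<xl)
  ... | tri> _ _ l<k = ⊥-elim (ℚₚ.<-asym xk<xl (x-mono l<k))

  x-injective : ∀ {k l} → x k ≡ x l → k ≡ l
  x-injective {k} {l} xk≡xl with Finₚ.<-cmp k l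
  ... | tri< k<l _ _ = ⊥-elim (ℚₚ.<-irrefl xk≡xl (x-mono k<l))
  ... | tri≈ _ k≡l _ = k≡l
  ... | tri> _ _ l<k = ⊥-elim (ℚₚ.<-irrefl (sym xk≡xl) (x-mono l<k))

  -- punchIn j k is the k-th smallest index other than j, so `maps` says that y ↦ a y + b sends
  -- the k-th smallest element of S ∖ {s_j} to the k-th smallest element of S ∖ {s_i}.
  record OrderedCopy (i j : Fin (suc m)) : Set where
    field
      a b  : ℚ
      0<a  : 0ℚ < a
      maps : ∀ k → a * x (punchIn j k) + b ≡ x (punchIn i k)

  -- The copy induces an increasing self-map σ of the ranks, which must be the identity.
  isCopy⇒orderedCopy : ∀ {i j} → IsCopy (Remove s i) (Remove s j) → OrderedCopy i j
  isCopy⇒orderedCopy {i} {j} (a , b , 0<a , copy) = record { a = a ; b = b ; 0<a = 0<a ; maps = maps }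
    where
    image : ∀ k → Σ (Fin m) λ l → a * x (punchIn j k) + b ≡ x (punchIn i l)
    image k with proj₂ (copy (a * x (punchIn j k) + b)) (x (punchIn j k) , (punchIn j k , Finₚ.punchInᵢ≢i j k , refl) , refl)
    ... | l , l≢i , eq = punchOut (l≢i ∘ sym) , trans eq (cong x (sym (Finₚ.punchIn-punchOut (l≢i ∘ sym))))
    σ : Fin m → Fin m
    σ k = proj₁ (image k)
    σ-inc : ∀ {k l} → k Fin.< l → σ k Fin.< σ l
    σ-inc {k} {l} k<l = punchIn-cancel-< i (x-cancel-< (subst₂ _<_ (proj₂ (image k)) (proj₂ (image l))
      (affine-strictMono {a} {b} 0<a (x-mono (punchIn-mono-< j k<l)))))
    maps : ∀ k → a * x (punchIn j k) + b ≡ x (punchIn i k)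
    maps k = subst (λ l → a * x (punchIn j k) + b ≡ x (punchIn i l)) (strictlyIncreasing⇒≡id σ σ-inc k) (proj₂ (image k))

  module _ {i j} (c : OrderedCopy i j) (i<j : i Fin.< j) where
    open OrderedCopy c

    private
      maps-at : ∀ k {u v} → punchIn j k ≡ u → punchIn i k ≡ v → a * x u + b ≡ x v
      maps-at k refl refl = maps k

    fixes-below : ∀ k → toℕ k ℕ.< toℕ i → a * x (inject₁ k) + b ≡ x (inject₁ k)
    fixes-below k k<i = maps-at k (punchIn-< j k (ℕₚ.<-trans k<i i<j)) (punchIn-< i k k<i)

    shifts : ∀ k → toℕ i ℕ.≤ toℕ k → toℕ k ℕ.< toℕ j → a * x (inject₁ k) + b ≡ x (suc k)
    shifts k i≤k k<j = maps-at k (punchIn-< j k k<j) (punchIn-≥ i k i≤k)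

    fixes-above : ∀ k → toℕ j ℕ.≤ toℕ k → a * x (suc k) + b ≡ x (suc k)
    fixes-above k j≤k = maps-at k (punchIn-≥ j k j≤k) (punchIn-≥ i k (ℕₚ.≤-trans (ℕₚ.<⇒≤ i<j) j≤k))

    -- A copy fixing two points of S is the identity, yet it moves s_i ∈ S ∖ {s_j} into S ∖ {s_i}.
    fixedPoint-unique : ∀ {u v} → a * x u + b ≡ x u → a * x v + b ≡ x v → u ≡ v
    fixedPoint-unique {u} {v} fu fv with u Finₚ.≟ v
    ... | yes u≡v = u≡v
    ... | no u≢v = contradiction (x-injective xᵢ≡x[punchIn-i-t]) (Finₚ.punchInᵢ≢i i t ∘ sym)
      where
      open ≡-Reasoning
      j≢i : j ≢ i
      j≢i = Finₚ.<⇒≢ i<j ∘ sym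
      t : Fin m
      t = punchOut j≢i
      xᵢ≡x[punchIn-i-t] : x i ≡ x (punchIn i t)
      xᵢ≡x[punchIn-i-t] = begin
        x i               ≡⟨ affine-identity {a} {b} fu fv (u≢v ∘ x-injective) (x i) ⟨
        a * x i + b       ≡⟨ maps-at t (Finₚ.punchIn-punchOut j≢i) refl ⟩
        x (punchIn i t)   ∎

module Classification {r} (s : Fin (4 ℕ.+ r) → ℕ) (s-inc : StrictlyIncreasing s) where
  open Symmetries s s-inc
  open OrderedCopy
  open import Data.Rational using (_+_; _*_)
  open ≡-Reasoning

  -- With 0-based indices and n = 4 + r, these are the paper's types (1,n), (1,n-1) and (2,n).
  data SymmetryType : Fin (4 ℕ.+ r) → Fin (4 ℕ.+ r) → Set where
    shift              : ∀ {j} → toℕ j ≡ 3 ℕ.+ r → SymmetryType zero j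
    shift-fixing-last  : ∀ {j} → toℕ j ≡ 2 ℕ.+ r → SymmetryType zero j
    shift-fixing-first : ∀ {j} → toℕ j ≡ 3 ℕ.+ r → SymmetryType (suc zero) j

  top : Fin (3 ℕ.+ r)
  top = fromℕ (2 ℕ.+ r)

  top⁻ : Fin (3 ℕ.+ r)
  top⁻ = inject₁ (fromℕ (1 ℕ.+ r))

  toℕ≤2+r : ∀ (j : Fin (4 ℕ.+ r)) → toℕ j ≢ 3 ℕ.+ r → toℕ j ℕ.≤ 2 ℕ.+ r
  toℕ≤2+r j j≢3+r = ℕₚ.≤-pred (ℕₚ.≤∧≢⇒< (Finₚ.toℕ≤pred[n] j) j≢3+r)

  toℕ≤1+r : ∀ (j : Fin (4 ℕ.+ r)) → toℕ j ≢ 3 ℕ.+ r → toℕ j ≢ 2 ℕ.+ r → toℕ j ℕ.≤ 1 ℕ.+ r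
  toℕ≤1+r j j≢3+r j≢2+r = ℕₚ.≤-pred (ℕₚ.≤∧≢⇒< (toℕ≤2+r j j≢3+r) j≢2+r)

  classify : ∀ {i j} → OrderedCopy i j → i Fin.< j → SymmetryType i j
  classify {suc (suc _)} {zero} _ ()
  classify {suc (suc _)} {suc zero} _ (s≤s ())
  classify {suc (suc _)} {suc (suc _)} c i<j = contradiction
    (fixedPoint-unique c i<j (fixes-below c i<j zero (s≤s z≤n)) (fixes-below c i<j (suc zero) (s≤s (s≤s z≤n))))
    λ ()
  classify {suc zero} {j} c i<j with toℕ j ℕ.≟ 3 ℕ.+ r
  ... | yes j≡3+r = shift-fixing-first j≡3+r
  ... | no j≢3+r = contradiction
    (fixedPoint-unique c i<j (fixes-below c i<j zero (s≤s z≤n))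
      (fixes-above c i<j top (subst (toℕ j ℕ.≤_) (sym (Finₚ.toℕ-fromℕ _)) (toℕ≤2+r j j≢3+r))))
    λ ()
  classify {zero} {j} c i<j with toℕ j ℕ.≟ 3 ℕ.+ r | toℕ j ℕ.≟ 2 ℕ.+ r
  ... | yes j≡3+r | _         = shift j≡3+r
  ... | no _      | yes j≡2+r = shift-fixing-last j≡2+r
  ... | no j≢3+r  | no j≢2+r  = contradiction
    (fixedPoint-unique c i<j
      (fixes-above c i<j top⁻ (subst (toℕ j ℕ.≤_) (sym toℕ-top⁻) (toℕ≤1+r j j≢3+r j≢2+r)))
      (fixes-above c i<j top (ℕₚ.≤-trans (toℕ≤1+r j j≢3+r j≢2+r) (ℕₚ.≤-trans (ℕₚ.n≤1+n _) (ℕₚ.≤-reflexive (sym (Finₚ.toℕ-fromℕ _)))))))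
    (inject₁≢suc (fromℕ (1 ℕ.+ r)) ∘ Finₚ.suc-injective)
    where
    toℕ-top⁻ : toℕ top⁻ ≡ 1 ℕ.+ r
    toℕ-top⁻ = trans (Finₚ.toℕ-inject₁ _) (Finₚ.toℕ-fromℕ _)

  private
    <-toℕ : ∀ {t k} {j : Fin (4 ℕ.+ r)} → toℕ j ≡ k → t ℕ.< k → t ℕ.< toℕ j
    <-toℕ j≡k t<k = subst (_ ℕ.<_) (sym j≡k) t<k

    x₀≢x₁ : x zero ≢ x (suc zero)
    x₀≢x₁ x₀≡x₁ with x-injective x₀≡x₁
    ... | ()

    x₁≢x₂ : x (suc zero) ≢ x (suc (suc zero))
    x₁≢x₂ x₁≡x₂ with x-injective x₁≡x₂
    ... | ()

  shift-and-fixing-first-clash : ∀ {j j′} → OrderedCopy zero j → 2 ℕ.< toℕ j →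
    OrderedCopy (suc zero) j′ → toℕ j′ ≡ 3 ℕ.+ r → ⊥
  shift-and-fixing-first-clash {j} {j′} f 2<j g j′≡3+r = x₀≢x₁ (three-step-clash {a f} {b f} {a g} {b g}
    (shifts f 0<j zero z≤n 0<j) (shifts f 0<j (suc zero) z≤n 1<j) (shifts f 0<j (suc (suc zero)) z≤n 2<j)
    (fixes-below g 1<j′ zero (s≤s z≤n)) (shifts g 1<j′ (suc zero) ℕₚ.≤-refl 1<j′)
    (shifts g 1<j′ (suc (suc zero)) (s≤s z≤n) (<-toℕ j′≡3+r (s≤s (s≤s (s≤s z≤n)))))
    x₁≢x₂)
    where
    1<j = ℕₚ.<-trans (s≤s (s≤s z≤n)) 2<j
    0<j = ℕₚ.<-trans (s≤s z≤n) 1<j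
    1<j′ = <-toℕ j′≡3+r (s≤s (s≤s z≤n))

  shift-and-fixing-last-clash : ∀ {j j′} → OrderedCopy zero j → toℕ j ≡ 3 ℕ.+ r →
    OrderedCopy zero j′ → toℕ j′ ≡ 2 ℕ.+ r → ⊥
  shift-and-fixing-last-clash {j} {j′} f j≡3+r g j′≡2+r =
    inject₁≢suc top (x-injective (affine-injective {a f} {b f} (0<a f) (begin
      a f * x (inject₁ top) + b f ≡⟨ shifts f 0<j top z≤n (<-toℕ j≡3+r (ℕₚ.≤-reflexive (cong suc toℕ-top))) ⟩
      x (suc top)                 ≡⟨ fixes-above g 0<j′ top (ℕₚ.≤-reflexive (trans j′≡2+r (sym toℕ-top))) ⟨
      a g * x (suc top) + b g     ≡⟨ cong₂ (λ a b → a * x (suc top) + b) (proj₁ f≡g) (proj₂ f≡g) ⟨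
      a f * x (suc top) + b f     ∎)))
    where
    toℕ-top : toℕ top ≡ 2 ℕ.+ r
    toℕ-top = Finₚ.toℕ-fromℕ _
    0<j = <-toℕ j≡3+r (s≤s z≤n)
    0<j′ = <-toℕ j′≡2+r (s≤s z≤n)
    1<j′ = <-toℕ j′≡2+r (s≤s (s≤s z≤n))
    f≡g : a f ≡ a g × b f ≡ b g
    f≡g = affine-determined {a f} {b f} {a g} {b g}
      (trans (shifts f 0<j zero z≤n 0<j) (sym (shifts g 0<j′ zero z≤n 0<j′)))
      (trans (shifts f 0<j (suc zero) z≤n (<-toℕ j≡3+r (s≤s (s≤s z≤n)))) (sym (shifts g 0<j′ (suc zero) z≤n 1<j′)))
      x₀≢x₁

  fixing-last-and-fixing-first-clash : ∀ {j j′} → OrderedCopy zero j → toℕ j ≡ 2 ℕ.+ r →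
    OrderedCopy (suc zero) j′ → toℕ j′ ≡ 3 ℕ.+ r → ⊥
  fixing-last-and-fixing-first-clash {j} {j′} f j≡2+r g j′≡3+r with 2 ℕ.<? toℕ j
  ... | yes 2<j = shift-and-fixing-first-clash f 2<j g j′≡3+r
  ... | no 2≮j = golden-clash {a = a f} {b f} {a g} {b g} (ℕₚ.<⇒≤ (s-inc zero (suc zero) (s≤s z≤n)))
    (s-inc (suc zero) (suc (suc zero)) (s≤s (s≤s z≤n))) (ℕₚ.<⇒≤ (s-inc (suc (suc zero)) (suc (suc (suc zero))) (s≤s (s≤s (s≤s z≤n)))))
    (shifts f 0<j zero z≤n 0<j) (shifts f 0<j (suc zero) z≤n (<-toℕ j≡2+r (s≤s (s≤s z≤n))))
    (fixes-above f 0<j (suc (suc zero)) (ℕₚ.≮⇒≥ 2≮j))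
    (fixes-below g 1<j′ zero (s≤s z≤n)) (shifts g 1<j′ (suc zero) ℕₚ.≤-refl 1<j′)
    (shifts g 1<j′ (suc (suc zero)) (s≤s z≤n) (<-toℕ j′≡3+r (s≤s (s≤s (s≤s z≤n)))))
    where
    0<j = <-toℕ j≡2+r (s≤s z≤n)
    1<j′ = <-toℕ j′≡3+r (s≤s (s≤s z≤n))

  symmetry-unique : ∀ {i j i′ j′} → OrderedCopy i j → i Fin.< j → OrderedCopy i′ j′ → i′ Fin.< j′ →
    i ≡ i′ × j ≡ j′
  symmetry-unique c i<j c′ i′<j′ with classify c i<j | classify c′ i′<j′
  ... | shift e              | shift e′              = refl , Finₚ.toℕ-injective (trans e (sym e′))
  ... | shift-fixing-last e  | shift-fixing-last e′  = refl , Finₚ.toℕ-injective (trans e (sym e′))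
  ... | shift-fixing-first e | shift-fixing-first e′ = refl , Finₚ.toℕ-injective (trans e (sym e′))
  ... | shift e              | shift-fixing-last e′  = ⊥-elim (shift-and-fixing-last-clash c e c′ e′)
  ... | shift-fixing-last e  | shift e′              = ⊥-elim (shift-and-fixing-last-clash c′ e′ c e)
  ... | shift e              | shift-fixing-first e′ = ⊥-elim (shift-and-fixing-first-clash c (<-toℕ e (s≤s (s≤s (s≤s z≤n)))) c′ e′)
  ... | shift-fixing-first e | shift e′              = ⊥-elim (shift-and-fixing-first-clash c′ (<-toℕ e′ (s≤s (s≤s (s≤s z≤n)))) c e)
  ... | shift-fixing-last e  | shift-fixing-first e′ = ⊥-elim (fixing-last-and-fixing-first-clash c e c′ e′)
  ... | shift-fixing-first e | shift-fixing-last e′  = ⊥-elim (fixing-last-and-fixing-first-clash c′ e′ c e)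

lemma3p9 : (n : ℕ) → 4 ≤ n → (s : Fin n → ℕ) → StrictlyIncreasing s →
    (i j i' j' : Fin n) → HasSymType s i j → HasSymType s i' j' →
    (i ≡ i') × (j ≡ j')
lemma3p9 (suc (suc (suc (suc r)))) (s≤s (s≤s (s≤s (s≤s _)))) s s-inc i j i′ j′ (i<j , copy) (i′<j′ , copy′) =
  Classification.symmetry-unique s s-inc (isCopy⇒orderedCopy copy) i<j (isCopy⇒orderedCopy copy′) i′<j′
  where open Symmetries s s-inc
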